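{- Let $G$ be a $(2P_3,C_4)$-free graph that admits a clique-cutset. Then $G$ contains a simplicial vertex.
   Context: All graphs are finite, simple and nonnull. $G$ is $H$-free if no induced subgraph is isomorphic to $H$; $2P_3$ is two disjoint copies of the 3-vertex path, $C_4$ the 4-cycle. A clique-cutset is a (possibly empty) clique $C\subsetneq V(G)$ such that $G\setminus C$ is disconnected. A simplicial vertex is one whose neighborhood is a (possibly empty) clique. -}

module Defs where

open import Data.Nat using (ℕ; suc)
open import Data.Fin using (Fin; zero; suc)
open import Data.Bool using (Bool; true; false; T)
open import Data.Product using (Σ; ∃; ∃-syntax; _×_; _,_)
open import Relation.Nullary using (¬_)
open import Relation.Binary.PropositionalEquality using (_≡_)
open import Function.Definitions using (Injective)
open import Function.Bundles using (_⇔_)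

record Graph (n : ℕ) : Set where
  field
    adj     : Fin n → Fin n → Bool
    sym     : ∀ u v → adj u v ≡ adj v u
    irrefl  : ∀ v → adj v v ≡ false

open Graph public

Adj : ∀ {n} → Graph n → Fin n → Fin n → Set
Adj G u v = T (adj G u v)

InducedSub : ∀ {k n} → Graph k → Graph n → Set
InducedSub {k} {n} H G =
  Σ (Fin k → Fin n) λ f →
    Injective _≡_ _≡_ f × (∀ i j → Adj G (f i) (f j) ⇔ Adj H i j)

Free : ∀ {k n} → Graph k → Graph n → Set
Free H G = ¬ InducedSub H G

-- Building a graph from an edge predicate given by a symmetric/irreflexive table.
-- 2P₃ on Fin 6: paths 0-1-2 and 3-4-5.
adj2P3 : Fin 6 → Fin 6 → Bool
adj2P3 zero (suc zero) = true
adj2P3 (suc zero) zero = true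
adj2P3 (suc zero) (suc (suc zero)) = true
adj2P3 (suc (suc zero)) (suc zero) = true
adj2P3 (suc (suc (suc zero))) (suc (suc (suc (suc zero)))) = true
adj2P3 (suc (suc (suc (suc zero)))) (suc (suc (suc zero))) = true
adj2P3 (suc (suc (suc (suc zero)))) (suc (suc (suc (suc (suc zero))))) = true
adj2P3 (suc (suc (suc (suc (suc zero))))) (suc (suc (suc (suc zero)))) = true
adj2P3 _ _ = false

2P₃ : Graph 6
2P₃ = record { adj = adj2P3 ; sym = s ; irrefl = r }
  where
  s : ∀ u v → adj2P3 u v ≡ adj2P3 v u
  s zero zero = _≡_.refl
  s zero (suc zero) = _≡_.refl
  s zero (suc (suc zero)) = _≡_.refl
  s zero (suc (suc (suc zero))) = _≡_.refl
  s zero (suc (suc (suc (suc zero)))) = _≡_.refl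
  s zero (suc (suc (suc (suc (suc zero))))) = _≡_.refl
  s (suc zero) zero = _≡_.refl
  s (suc zero) (suc zero) = _≡_.refl
  s (suc zero) (suc (suc zero)) = _≡_.refl
  s (suc zero) (suc (suc (suc zero))) = _≡_.refl
  s (suc zero) (suc (suc (suc (suc zero)))) = _≡_.refl
  s (suc zero) (suc (suc (suc (suc (suc zero))))) = _≡_.refl
  s (suc (suc zero)) zero = _≡_.refl
  s (suc (suc zero)) (suc zero) = _≡_.refl
  s (suc (suc zero)) (suc (suc zero)) = _≡_.refl
  s (suc (suc zero)) (suc (suc (suc zero))) = _≡_.refl
  s (suc (suc zero)) (suc (suc (suc (suc zero)))) = _≡_.refl
  s (suc (suc zero)) (suc (suc (suc (suc (suc zero))))) = _≡_.refl
  s (suc (suc (suc zero))) zero = _≡_.refl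
  s (suc (suc (suc zero))) (suc zero) = _≡_.refl
  s (suc (suc (suc zero))) (suc (suc zero)) = _≡_.refl
  s (suc (suc (suc zero))) (suc (suc (suc zero))) = _≡_.refl
  s (suc (suc (suc zero))) (suc (suc (suc (suc zero)))) = _≡_.refl
  s (suc (suc (suc zero))) (suc (suc (suc (suc (suc zero))))) = _≡_.refl
  s (suc (suc (suc (suc zero)))) zero = _≡_.refl
  s (suc (suc (suc (suc zero)))) (suc zero) = _≡_.refl
  s (suc (suc (suc (suc zero)))) (suc (suc zero)) = _≡_.refl
  s (suc (suc (suc (suc zero)))) (suc (suc (suc zero))) = _≡_.refl
  s (suc (suc (suc (suc zero)))) (suc (suc (suc (suc zero)))) = _≡_.refl
  s (suc (suc (suc (suc zero)))) (suc (suc (suc (suc (suc zero))))) = _≡_.refl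
  s (suc (suc (suc (suc (suc zero))))) zero = _≡_.refl
  s (suc (suc (suc (suc (suc zero))))) (suc zero) = _≡_.refl
  s (suc (suc (suc (suc (suc zero))))) (suc (suc zero)) = _≡_.refl
  s (suc (suc (suc (suc (suc zero))))) (suc (suc (suc zero))) = _≡_.refl
  s (suc (suc (suc (suc (suc zero))))) (suc (suc (suc (suc zero)))) = _≡_.refl
  s (suc (suc (suc (suc (suc zero))))) (suc (suc (suc (suc (suc zero))))) = _≡_.refl
  r : ∀ v → adj2P3 v v ≡ false
  r zero = _≡_.refl
  r (suc zero) = _≡_.refl
  r (suc (suc zero)) = _≡_.refl
  r (suc (suc (suc zero))) = _≡_.refl
  r (suc (suc (suc (suc zero)))) = _≡_.refl
  r (suc (suc (suc (suc (suc zero))))) = _≡_.refl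

-- C₄ on Fin 4: cycle 0-1-2-3-0.
adjC4 : Fin 4 → Fin 4 → Bool
adjC4 zero (suc zero) = true
adjC4 (suc zero) zero = true
adjC4 (suc zero) (suc (suc zero)) = true
adjC4 (suc (suc zero)) (suc zero) = true
adjC4 (suc (suc zero)) (suc (suc (suc zero))) = true
adjC4 (suc (suc (suc zero))) (suc (suc zero)) = true
adjC4 (suc (suc (suc zero))) zero = true
adjC4 zero (suc (suc (suc zero))) = true
adjC4 _ _ = false

C₄ : Graph 4
C₄ = record { adj = adjC4 ; sym = s ; irrefl = r }
  where
  s : ∀ u v → adjC4 u v ≡ adjC4 v u
  s zero zero = _≡_.refl
  s zero (suc zero) = _≡_.refl
  s zero (suc (suc zero)) = _≡_.refl
  s zero (suc (suc (suc zero))) = _≡_.refl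
  s (suc zero) zero = _≡_.refl
  s (suc zero) (suc zero) = _≡_.refl
  s (suc zero) (suc (suc zero)) = _≡_.refl
  s (suc zero) (suc (suc (suc zero))) = _≡_.refl
  s (suc (suc zero)) zero = _≡_.refl
  s (suc (suc zero)) (suc zero) = _≡_.refl
  s (suc (suc zero)) (suc (suc zero)) = _≡_.refl
  s (suc (suc zero)) (suc (suc (suc zero))) = _≡_.refl
  s (suc (suc (suc zero))) zero = _≡_.refl
  s (suc (suc (suc zero))) (suc zero) = _≡_.refl
  s (suc (suc (suc zero))) (suc (suc zero)) = _≡_.refl
  s (suc (suc (suc zero))) (suc (suc (suc zero))) = _≡_.refl
  r : ∀ v → adjC4 v v ≡ false
  r zero = _≡_.refl
  r (suc zero) = _≡_.refl
  r (suc (suc zero)) = _≡_.refl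
  r (suc (suc (suc zero))) = _≡_.refl

VSet : ℕ → Set
VSet n = Fin n → Bool

_∈ₛ_ : ∀ {n} → Fin n → VSet n → Set
v ∈ₛ S = T (S v)

_∉ₛ_ : ∀ {n} → Fin n → VSet n → Set
v ∉ₛ S = ¬ (v ∈ₛ S)

IsClique : ∀ {n} → Graph n → VSet n → Set
IsClique G S = ∀ u v → u ∈ₛ S → v ∈ₛ S → ¬ (u ≡ v) → Adj G u v

-- Connectivity in G ∖ C: u and v are joined by a walk avoiding C
-- (u, v themselves are assumed outside C).
data ConnAvoid {n} (G : Graph n) (C : VSet n) : Fin n → Fin n → Set where
  here : ∀ {u} → ConnAvoid G C u u
  step : ∀ {u w v} → Adj G u w → w ∉ₛ C → ConnAvoid G C w v → ConnAvoid G C u v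

IsCliqueCutset : ∀ {n} → Graph n → VSet n → Set
IsCliqueCutset G C =
  IsClique G C ×
  (∃[ u ] ∃[ v ] (u ∉ₛ C × v ∉ₛ C × ¬ ConnAvoid G C u v))

HasCliqueCutset : ∀ {n} → Graph n → Set
HasCliqueCutset G = ∃[ C ] IsCliqueCutset G C

IsSimplicial : ∀ {n} → Graph n → Fin n → Set
IsSimplicial G v =
  ∀ x y → Adj G v x → Adj G v y → ¬ (x ≡ y) → Adj G x y

{-# OPTIONS --safe #-}
-- Suppose no vertex is simplicial, and let the clique C separate u from v. If the
-- component K of u in G ∖ C were a clique, take x ∈ K with N(x) ∩ C minimal under
-- inclusion. Being non-simplicial, x has non-adjacent neighbours p, q; they are
-- neither both in the clique C nor both in the clique K, so say p ∈ C and q ∈ K.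
-- Any d ∈ N(q) ∩ C is adjacent to x, as otherwise x p d q is an induced C₄; hence
-- N(q) ∩ C ⊊ N(x) ∩ C, contradicting minimality. So neither component is a clique,
-- each one, being connected, contains an induced P₃, and the two P₃'s form an induced 2P₃.
module Submission where

open import Defs
open import Data.Nat using (ℕ)
open import Data.Fin using (Fin)
open import Data.Product using (∃-syntax; _×_)

open import Data.Bool using (Bool; true; false; T)
open import Data.Bool.Properties using (T?; T-≡; ¬-not)
open import Data.Fin using (zero; suc; _<_)
open import Data.Fin.Properties using (_≟_; <-cmp; any?)
open import Data.Fin.Subset using (Subset; _∈_; _⊂_; _∩_)
open import Data.Fin.Subset.Properties using (x∈p∩q⁺; x∈p∩q⁻)
open import Data.Fin.Subset.Induction using (Acc; acc; ⊂-wellFounded)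
open import Data.List using (allFin; tabulate)
open import Data.List.Relation.Unary.All using ([]; _∷_)
import Data.List.Relation.Unary.All.Properties as All
open import Data.List.Relation.Unary.AllPairs using (AllPairs; []; _∷_)
open import Data.Nat using (s≤s)
open import Data.Product using (_,_; proj₁; proj₂)
open import Data.Sum using (_⊎_; inj₁; inj₂)
open import Data.Vec as Vec using ([]; _∷_; lookup)
open import Data.Vec.Properties using (lookup∘tabulate; []=⇒lookup; lookup⇒[]=)
open import Function using (_∘_)
open import Function.Bundles using (mk⇔; Equivalence)
open import Relation.Binary using (Rel; tri<; tri≈; tri>)
open import Relation.Binary.PropositionalEquality as ≡ using (_≡_; _≢_; refl; subst)
open import Relation.Nullary using (¬_; Dec; yes; no; contradiction)
open import Relation.Nullary.Decidable using (decidable-stable; _×-dec_; ¬?)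

module _ {n} (G : Graph n) where

  Adj-sym : ∀ {a b} → Adj G a b → Adj G b a
  Adj-sym {a} {b} = subst T (Graph.sym G a b)

  Adj⇒≢ : ∀ {a b} → Adj G a b → a ≢ b
  Adj⇒≢ {a} a~a refl = subst T (irrefl G a) a~a

  Realises : Bool → Fin n → Fin n → Set
  Realises true  a b = Adj G a b
  Realises false a b = ¬ Adj G a b × a ≢ b

  Realises? : ∀ e a b → Dec (Realises e a b)
  Realises? true  a b = T? (adj G a b)
  Realises? false a b = ¬? (T? (adj G a b)) ×-dec ¬? (a ≟ b)

  Realises-sym : ∀ e {a b} → Realises e a b → Realises e b a
  Realises-sym true  a~b         = Adj-sym a~b
  Realises-sym false (a≁b , a≢b) = a≁b ∘ Adj-sym , a≢b ∘ ≡.sym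

  Realises⇒adj≡ : ∀ e {a b} → Realises e a b → adj G a b ≡ e
  Realises⇒adj≡ true  a~b       = Equivalence.to T-≡ a~b
  Realises⇒adj≡ false (a≁b , _) = ¬-not (a≁b ∘ Equivalence.from T-≡)

  Realises⇒≢ : ∀ e {a b} → Realises e a b → a ≢ b
  Realises⇒≢ true  = Adj⇒≢
  Realises⇒≢ false = proj₂

module _ {a r} {A : Set a} {R : Rel A r} where

  AllPairs-tabulate⁻ : ∀ {k} {f : Fin k → A} → AllPairs R (tabulate f) →
                       ∀ {i j} → i < j → R (f i) (f j)
  AllPairs-tabulate⁻ (f₀~ ∷ _) {zero}  {suc j} _         = All.tabulate⁻ f₀~ j
  AllPairs-tabulate⁻ (_ ∷ f~f) {suc i} {suc j} (s≤s i<j) = AllPairs-tabulate⁻ f~f i<j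

-- Only the pairs i < j need evidence: symmetry gives the pairs i > j, and
-- irreflexivity the diagonal.
induced-from-pairs : ∀ {k n} (H : Graph k) (G : Graph n) (f : Fin k → Fin n) →
  AllPairs (λ i j → Realises G (adj H i j) (f i) (f j)) (allFin k) → InducedSub H G
induced-from-pairs H G f table =
  f , injective , λ i j → mk⇔ (subst T (adj≡ i j)) (subst T (≡.sym (adj≡ i j)))
  where
  realises : ∀ {i j} → i ≢ j → Realises G (adj H i j) (f i) (f j)
  realises {i} {j} i≢j with <-cmp i j
  ... | tri< i<j _ _ = AllPairs-tabulate⁻ table i<j
  ... | tri≈ _ i≡j _ = contradiction i≡j i≢j
  ... | tri> _ _ j<i = subst (λ e → Realises G e (f i) (f j)) (Graph.sym H j i)
                             (Realises-sym G (adj H j i) (AllPairs-tabulate⁻ table j<i))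

  adj≡ : ∀ i j → adj G (f i) (f j) ≡ adj H i j
  adj≡ i j with i ≟ j
  ... | yes refl = ≡.trans (irrefl G (f i)) (≡.sym (irrefl H i))
  ... | no i≢j   = Realises⇒adj≡ G (adj H i j) (realises i≢j)

  injective : ∀ {i j} → f i ≡ f j → i ≡ j
  injective {i} {j} fi≡fj =
    decidable-stable (i ≟ j) λ i≢j → Realises⇒≢ G (adj H i j) (realises i≢j) fi≡fj

C₄-induced : ∀ {n} (G : Graph n) {a b c d} →
  Adj G a b → Adj G b c → Adj G c d → Adj G d a →
  Realises G false a c → Realises G false b d → InducedSub C₄ G
C₄-induced G {a} {b} {c} {d} a~b b~c c~d d~a a≁c b≁d =
  induced-from-pairs C₄ G (lookup (a ∷ b ∷ c ∷ d ∷ []))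
    ( (a~b ∷ a≁c ∷ Adj-sym G d~a ∷ [])
    ∷ (b~c ∷ b≁d ∷ [])
    ∷ (c~d ∷ [])
    ∷ []
    ∷ [])

record InducedP₃ {n} (G : Graph n) (A : Fin n → Set) : Set where
  field
    {a b c} : Fin n
    a∈A     : A a
    b∈A     : A b
    c∈A     : A c
    a~b     : Adj G a b
    b~c     : Adj G b c
    a≁c     : Realises G false a c

2P₃-induced : ∀ {n} (G : Graph n) {A B : Fin n → Set} →
  (∀ {x y} → A x → B y → Realises G false x y) →
  InducedP₃ G A → InducedP₃ G B → InducedSub 2P₃ G
2P₃-induced G A≁B P Q =
  induced-from-pairs 2P₃ G (lookup (P.a ∷ P.b ∷ P.c ∷ Q.a ∷ Q.b ∷ Q.c ∷ []))
    ( (P.a~b ∷ P.a≁c ∷ A≁B P.a∈A Q.a∈A ∷ A≁B P.a∈A Q.b∈A ∷ A≁B P.a∈A Q.c∈A ∷ [])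
    ∷ (P.b~c ∷ A≁B P.b∈A Q.a∈A ∷ A≁B P.b∈A Q.b∈A ∷ A≁B P.b∈A Q.c∈A ∷ [])
    ∷ (A≁B P.c∈A Q.a∈A ∷ A≁B P.c∈A Q.b∈A ∷ A≁B P.c∈A Q.c∈A ∷ [])
    ∷ (Q.a~b ∷ Q.a≁c ∷ [])
    ∷ (Q.b~c ∷ [])
    ∷ []
    ∷ [])
  where
  module P = InducedP₃ P
  module Q = InducedP₃ Q

module _ {n} (G : Graph n) where

  simplicial-or-obstruction : ∀ v → IsSimplicial G v ⊎
    ∃[ p ] ∃[ q ] (Adj G v p × Adj G v q × Realises G false p q)
  simplicial-or-obstruction v
    with any? (λ p → any? (λ q →
           T? (adj G v p) ×-dec T? (adj G v q) ×-dec Realises? G false p q))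
  ... | yes obstruction   = inj₂ obstruction
  ... | no no-obstruction = inj₁ λ x y v~x v~y x≢y →
    decidable-stable (T? (adj G x y)) λ x≁y → no-obstruction (x , y , v~x , v~y , x≁y , x≢y)

  simplicial? : ∀ v → Dec (IsSimplicial G v)
  simplicial? v with simplicial-or-obstruction v
  ... | inj₁ v-simplicial = yes v-simplicial
  ... | inj₂ (p , q , v~p , v~q , p≁q , p≢q) =
    no λ v-simplicial → p≁q (v-simplicial p q v~p v~q p≢q)

  IsCliqueOn : (Fin n → Set) → Set
  IsCliqueOn A = ∀ {x y} → A x → A y → x ≢ y → Adj G x y

∈-tabulate⁺ : ∀ {n} {S : VSet n} {v} → v ∈ₛ S → v ∈ Vec.tabulate S
∈-tabulate⁺ {S = S} {v} v∈S =
  lookup⇒[]= v (Vec.tabulate S) (≡.trans (lookup∘tabulate S v) (Equivalence.to T-≡ v∈S))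

∈-tabulate⁻ : ∀ {n} {S : VSet n} {v} → v ∈ Vec.tabulate S → v ∈ₛ S
∈-tabulate⁻ {S = S} {v} v∈S =
  Equivalence.from T-≡ (≡.trans (≡.sym (lookup∘tabulate S v)) ([]=⇒lookup v∈S))

module _ {n} (G : Graph n) (C : VSet n) where

  _++ʷ_ : ∀ {x y z} → ConnAvoid G C x y → ConnAvoid G C y z → ConnAvoid G C x z
  here             ++ʷ y⇝z = y⇝z
  step x~w w∉C w⇝y ++ʷ y⇝z = step x~w w∉C (w⇝y ++ʷ y⇝z)

  reverseʷ : ∀ {x y} → x ∉ₛ C → ConnAvoid G C x y → ConnAvoid G C y x
  reverseʷ x∉C here               = here
  reverseʷ x∉C (step x~w w∉C w⇝y) = reverseʷ w∉C w⇝y ++ʷ step (Adj-sym G x~w) x∉C here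

  Component : Fin n → Fin n → Set
  Component r x = x ∉ₛ C × ConnAvoid G C r x

  Component-extend : ∀ {r x y} → Component r x → ConnAvoid G C x y → Component r y
  Component-extend x∈K here = x∈K
  Component-extend (_ , r⇝x) (step x~w w∉C w⇝y) =
    Component-extend (w∉C , r⇝x ++ʷ step x~w w∉C here) w⇝y

  Component-walk : ∀ {r x y} → r ∉ₛ C → Component r x → Component r y → ConnAvoid G C x y
  Component-walk r∉C (_ , r⇝x) (_ , r⇝y) = reverseʷ r∉C r⇝x ++ʷ r⇝y

  separated-components-nonadjacent : ∀ {u v x y} → v ∉ₛ C → ¬ ConnAvoid G C u v →
    Component u x → Component v y → Realises G false x y
  separated-components-nonadjacent v∉C u↮v (_ , u⇝x) (y∉C , v⇝y) =
    (λ x~y → u↮v (u⇝x ++ʷ step x~y y∉C y⇝v)) , λ { refl → u↮v (u⇝x ++ʷ y⇝v) }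
    where
    y⇝v = reverseʷ v∉C v⇝y

  walk⇒InducedP₃ : ∀ {r x y} → Component r x → ConnAvoid G C x y → Realises G false x y →
    InducedP₃ G (Component r)
  walk⇒InducedP₃ x∈K here (_ , x≢x) = contradiction refl x≢x
  walk⇒InducedP₃ {y = y} x∈K (step {w = w} x~w w∉C w⇝y) x≁y with T? (adj G w y)
  ... | yes w~y = record { a∈A = x∈K ; b∈A = w∈K ; c∈A = Component-extend w∈K w⇝y
                         ; a~b = x~w ; b~c = w~y ; a≁c = x≁y }
    where
    w∈K = Component-extend x∈K (step x~w w∉C here)
  ... | no w≁y = walk⇒InducedP₃ (Component-extend x∈K (step x~w w∉C here)) w⇝y
                   (w≁y , λ { refl → proj₁ x≁y x~w })

  P₃-free-component⇒clique : ∀ {r} → r ∉ₛ C → ¬ InducedP₃ G (Component r) →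
    IsCliqueOn G (Component r)
  P₃-free-component⇒clique r∉C no-P₃ {x} {y} x∈K y∈K x≢y =
    decidable-stable (T? (adj G x y)) λ x≁y →
      no-P₃ (walk⇒InducedP₃ x∈K (Component-walk r∉C x∈K y∈K) (x≁y , x≢y))

  N∩C : Fin n → Subset n
  N∩C x = Vec.tabulate C ∩ Vec.tabulate (adj G x)

  ∈-N∩C⁺ : ∀ {x d} → d ∈ₛ C → Adj G x d → d ∈ N∩C x
  ∈-N∩C⁺ d∈C x~d = x∈p∩q⁺ (∈-tabulate⁺ d∈C , ∈-tabulate⁺ x~d)

  ∈-N∩C⁻ : ∀ {x d} → d ∈ N∩C x → d ∈ₛ C × Adj G x d
  ∈-N∩C⁻ {x} d∈N∩C with x∈p∩q⁻ (Vec.tabulate C) (Vec.tabulate (adj G x)) d∈N∩C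
  ... | d∈C , x~d = ∈-tabulate⁻ d∈C , ∈-tabulate⁻ x~d

  N∩C-shrinks : Free C₄ G → IsClique G C → ∀ {x c y} → x ∉ₛ C → c ∈ₛ C → y ∉ₛ C →
    Adj G x c → Adj G x y → ¬ Adj G c y → N∩C y ⊂ N∩C x
  N∩C-shrinks C₄-free C-clique {x} {c} {y} x∉C c∈C y∉C x~c x~y c≁y =
    N∩C-mono , c , ∈-N∩C⁺ c∈C x~c , λ c∈N∩Cy → c≁y (Adj-sym G (proj₂ (∈-N∩C⁻ c∈N∩Cy)))
    where
    N∩C-mono : ∀ {d} → d ∈ N∩C y → d ∈ N∩C x
    N∩C-mono {d} d∈N∩Cy with ∈-N∩C⁻ d∈N∩Cy
    ... | d∈C , y~d = ∈-N∩C⁺ d∈C (decidable-stable (T? (adj G x d)) λ x≁d →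
          C₄-free (C₄-induced G x~c c~d (Adj-sym G y~d) (Adj-sym G x~y)
                     (x≁d , λ { refl → x∉C d∈C }) (c≁y , λ { refl → y∉C c∈C })))
      where
      c~d : Adj G c d
      c~d = C-clique c d c∈C d∈C λ { refl → c≁y (Adj-sym G y~d) }

  clique-component⇒simplicial : Free C₄ G → IsClique G C → ∀ {r} → r ∉ₛ C →
    IsCliqueOn G (Component r) → ∃[ v ] IsSimplicial G v
  clique-component⇒simplicial C₄-free C-clique {r} r∉C K-clique =
    descend (⊂-wellFounded (N∩C r)) (r∉C , here)
    where
    descend : ∀ {x} → Acc _⊂_ (N∩C x) → Component r x → ∃[ v ] IsSimplicial G v
    descend-across : ∀ {x c y} → Acc _⊂_ (N∩C x) → Component r x → c ∈ₛ C → y ∉ₛ C →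
      Adj G x c → Adj G x y → Realises G false c y → ∃[ v ] IsSimplicial G v

    descend {x} acc-x x∈K with simplicial-or-obstruction G x
    ... | inj₁ x-simplicial = x , x-simplicial
    ... | inj₂ (p , q , x~p , x~q , p≁q) with T? (C p) | T? (C q)
    ... | yes p∈C | yes q∈C = contradiction (C-clique p q p∈C q∈C (proj₂ p≁q)) (proj₁ p≁q)
    ... | no p∉C  | no q∉C  = contradiction
            (K-clique (Component-extend x∈K (step x~p p∉C here))
                      (Component-extend x∈K (step x~q q∉C here)) (proj₂ p≁q)) (proj₁ p≁q)
    ... | yes p∈C | no q∉C  = descend-across acc-x x∈K p∈C q∉C x~p x~q p≁q
    ... | no p∉C  | yes q∈C =
      descend-across acc-x x∈K q∈C p∉C x~q x~p (Realises-sym G false p≁q)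

    descend-across (acc smaller) x∈K c∈C y∉C x~c x~y c≁y =
      descend (smaller (N∩C-shrinks C₄-free C-clique (proj₁ x∈K) c∈C y∉C x~c x~y (proj₁ c≁y)))
              (Component-extend x∈K (step x~y y∉C here))

proposition2p7 : ∀ {n} (G : Graph n) →
    Free 2P₃ G → Free C₄ G → HasCliqueCutset G →
    ∃[ v ] IsSimplicial G v
proposition2p7 G 2P₃-free C₄-free (C , C-clique , u , v , u∉C , v∉C , u↮v) =
  decidable-stable (any? (simplicial? G)) λ no-simplicial →
    let component-not-clique : ∀ {r} → r ∉ₛ C → ¬ IsCliqueOn G (Component G C r)
        component-not-clique r∉C =
          no-simplicial ∘ clique-component⇒simplicial G C C₄-free C-clique r∉C
    in component-not-clique u∉C (P₃-free-component⇒clique G C u∉C λ P →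
       component-not-clique v∉C (P₃-free-component⇒clique G C v∉C λ Q →
       2P₃-free (2P₃-induced G (separated-components-nonadjacent G C v∉C u↮v) P Q)))
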